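{- Let $\mathsf G$ be an extension of $\mathsf{G3p}$ by ordered box rules, and let $R_1,R_2$ be slim box rules such that $R_1^a\mid\!\sim_{\mathsf{GR}_1}R_2^a$ and $R_1^c=R_2^c$. Then for every sequent $S$: if $\vdash_{\mathsf{GR}_1}S$ then $\vdash^\circ_{\mathsf{GR}_2}S$.
   Context: Formulas are built from $\top,\bot$ and atoms using $\wedge,\vee,\neg,\to,\Box$, with the usual complexity (each connective and $\Box$ adds 1); $\boxdot\varphi$ abbreviates $\varphi\wedge\Box\varphi$. A sequent $\Gamma\Rightarrow\Delta$ consists of two finite multisets of formulas, interpreted as the formula $I(\Gamma\Rightarrow\Delta)=\bigwedge\Gamma\to\bigvee\Delta$; $S^a,S^s$ denote antecedent and succedent; $S_1\cdot S_2=(S_1^a\cup S_2^a\Rightarrow S_1^s\cup S_2^s)$; $\Box\Gamma=\{\Box\varphi:\varphi\in\Gamma\}$, $\boxdot\Gamma=\Gamma\cup\Box\Gamma$, $\Box S=(\Box S^a\Rightarrow\Box S^s)$. A rule is a scheme $S_1\dots S_n/S_0$; $R^c$ denotes its conclusion $I(S_0)$ and $R^a$ the conjunction $\bigwedge_iI(S_i)$ of its premisses. $\mathsf{G3p}$ has the rules: axioms $\Gamma,p\Rightarrow p,\Delta$ ($p$ atom) and $\Gamma,\bot\Rightarrow\Delta$; $L\wedge$: $\Gamma,\varphi,\psi\Rightarrow\Delta\,/\,\Gamma,\varphi\wedge\psi\Rightarrow\Delta$; $R\wedge$: $\Gamma\Rightarrow\varphi,\Delta$ and $\Gamma\Rightarrow\psi,\Delta\,/\,\Gamma\Rightarrow\varphi\wedge\psi,\Delta$;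 $L\vee$: $\Gamma,\varphi\Rightarrow\Delta$ and $\Gamma,\psi\Rightarrow\Delta\,/\,\Gamma,\varphi\vee\psi\Rightarrow\Delta$; $R\vee$: $\Gamma\Rightarrow\varphi,\psi,\Delta\,/\,\Gamma\Rightarrow\varphi\vee\psi,\Delta$; $L\!\to$: $\Gamma\Rightarrow\varphi,\Delta$ and $\Gamma,\psi\Rightarrow\Delta\,/\,\Gamma,\varphi\to\psi\Rightarrow\Delta$; $R\!\to$: $\Gamma,\varphi\Rightarrow\psi,\Delta\,/\,\Gamma\Rightarrow\varphi\to\psi,\Delta$. For a calculus $\mathsf G$ and rule $R$, $\mathsf{GR}$ denotes $\mathsf G+R$. A rule $R$ is a box rule if: (i) its conclusion has the form $\Box S\cdot(\Gamma\Rightarrow\Sigma)$ with multiset variables $\Gamma,\Sigma$ not occurring in $S$ nor in the premisses; (ii) all premisses consist of subformulas of formulas in $S$; (iii) whenever $S_1\ \dots\ S_n/(\Gamma\Rightarrow\Sigma)\cdot\Box(S_0\cdot S_0'\cdot S_0')$ is an instance of $R$, there are $S_i',S_i''$ with $S_i=S_i'\cdot S_i''\cdot S_i''$ such that $S_1'\cdot S_1''\ \dots\ S_n'\cdot S_n''/(\Gamma\Rightarrow\Sigma)\cdot\Box(S_0\cdot S_0')$ is an instance of $R$. Order on sequents: $\Gamma\prec^-_{dm}\Pi$ if $\Gamma$ results from $\Pi$ by replacing one formula by finitely many formulas of lower complexity; $\preccurlyeq_{dm}$ is its reflexive transitive closure; $S_1\preccurlyeq S_2$ iff $S_1^a\cup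 S_1^s\preccurlyeq_{dm}S_2^a\cup S_2^s$; $S_1\prec S_2$ iff $S_1\preccurlyeq S_2$ and $S_1\neq S_2$. A rule is ordered if in each instance all premisses are $\prec$-lower than the conclusion and consist solely of subformulas of formulas in the conclusion; an extension of $\mathsf{G3p}$ by ordered box rules is $\mathsf{G3p}$ plus finitely many ordered box rules. For a multiset $\Gamma$, $\Gamma_{\boxdot}$ is the largest set of the form $\boxdot\Pi$ with $\boxdot\Pi\subseteq\Gamma$, $\Gamma^*=\Gamma_{\boxdot}\cup\{\varphi\in\Gamma:\varphi\notin\Gamma_{\boxdot}\}$, $(\Gamma\Rightarrow\Delta)^*=(\Gamma^*\Rightarrow\Delta^*)$. A rule is slim if for every instance $S_1\dots S_n/S$, $S_1^*\dots S_n^*/S$ is also an instance. A substitution commutes with all connectives and $\Box$. The condition $R_1^a\mid\!\sim_{\mathsf{GR}_1}R_2^a$ together with $R_1^c=R_2^c$ means: the two rules have the same conclusion, and for every instantiation (and substitution) under which the premisses of $R_1$ are derivable in $\mathsf{GR}_1$, the correspondingly instantiated premisses of $R_2$ (with the same conclusion) are derivable in $\mathsf{GR}_1$. A derivation tree for $S$ in a calculus is a finite tree labelled by sequents with root $S$ whose inner nodes with their children are rule instances; a proof additionally has all leaves axiom instances; $\vdash_{\mathsf G}S$ means $S$ has a proof in $\mathsf G$. A leaf is circular if some node on its branch strictly below it carries the same label. A circular proof of $S$ in $\mathsf G$ is a derivation tree for $S$ in $\mathsf G$ each of whose leaves is an axiom instance or circular; $\vdash^\circ_{\mathsf G}S$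 means $S$ has a circular proof in $\mathsf G$. -}

module Defs where

open import Level using (0ℓ)
open import Data.Nat as ℕ using (ℕ; zero; suc; _<_; _⊔_)
import Data.Nat.Properties as ℕP
import Data.Empty as Empty
open import Data.Bool using (Bool; true; false; not)
open import Data.List using (List; []; _∷_; _++_; map; filter; deduplicate)
open import Data.List.Relation.Unary.All using (All)
open import Data.List.Relation.Unary.Any using (Any)
open import Data.List.Relation.Binary.Pointwise using (Pointwise)
open import Data.List.Relation.Binary.Permutation.Propositional using (_↭_)
open import Data.List.Relation.Binary.Subset.Propositional using (_⊆_)
open import Data.List.Membership.Propositional using (_∈_)
open import Data.Product using (Σ; ∃; _×_; _,_; proj₁; proj₂)
open import Data.Sum using (_⊎_; inj₁; inj₂)
open import Relation.Nullary using (¬_; Dec; yes; no)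
open import Relation.Nullary.Decidable using (_×-dec_; _⊎-dec_; ¬?)
open import Relation.Binary.PropositionalEquality using (_≡_; refl; cong; cong₂)
open import Relation.Binary.Construct.Closure.ReflexiveTransitive using (Star)

data Fml : Set where
  atom : ℕ → Fml
  ⊤′ ⊥′ : Fml
  _∧′_ _∨′_ _⇒′_ : Fml → Fml → Fml
  ¬′_ □_ : Fml → Fml

cpx : Fml → ℕ
cpx (atom _) = 0
cpx ⊤′ = 0
cpx ⊥′ = 0
cpx (φ ∧′ ψ) = suc (cpx φ ⊔ cpx ψ)
cpx (φ ∨′ ψ) = suc (cpx φ ⊔ cpx ψ)
cpx (φ ⇒′ ψ) = suc (cpx φ ⊔ cpx ψ)
cpx (¬′ φ) = suc (cpx φ)
cpx (□ φ) = suc (cpx φ)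

data Subf (φ : Fml) : Fml → Set where
  here : Subf φ φ
  ∧l : ∀ {a b} → Subf φ a → Subf φ (a ∧′ b)
  ∧r : ∀ {a b} → Subf φ b → Subf φ (a ∧′ b)
  ∨l : ∀ {a b} → Subf φ a → Subf φ (a ∨′ b)
  ∨r : ∀ {a b} → Subf φ b → Subf φ (a ∨′ b)
  ⇒l : ∀ {a b} → Subf φ a → Subf φ (a ⇒′ b)
  ⇒r : ∀ {a b} → Subf φ b → Subf φ (a ⇒′ b)
  ¬s : ∀ {a} → Subf φ a → Subf φ (¬′ a)
  □s : ∀ {a} → Subf φ a → Subf φ (□ a)

_≟_ : (φ ψ : Fml) → Dec (φ ≡ ψ)
atom m ≟ atom n with m ℕ.≟ n
... | yes refl = yes refl
... | no ne = no λ { refl → ne refl }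
⊤′ ≟ ⊤′ = yes refl
⊥′ ≟ ⊥′ = yes refl
(a ∧′ b) ≟ (c ∧′ d) with a ≟ c | b ≟ d
... | yes refl | yes refl = yes refl
... | no ne | _ = no λ { refl → ne refl }
... | yes _ | no ne = no λ { refl → ne refl }
(a ∨′ b) ≟ (c ∨′ d) with a ≟ c | b ≟ d
... | yes refl | yes refl = yes refl
... | no ne | _ = no λ { refl → ne refl }
... | yes _ | no ne = no λ { refl → ne refl }
(a ⇒′ b) ≟ (c ⇒′ d) with a ≟ c | b ≟ d
... | yes refl | yes refl = yes refl
... | no ne | _ = no λ { refl → ne refl }
... | yes _ | no ne = no λ { refl → ne refl }
(¬′ a) ≟ (¬′ c) with a ≟ c
... | yes refl = yes refl
... | no ne = no λ { refl → ne refl }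
(□ a) ≟ (□ c) with a ≟ c
... | yes refl = yes refl
... | no ne = no λ { refl → ne refl }
atom _ ≟ ⊤′ = no λ ()
atom _ ≟ ⊥′ = no λ ()
atom _ ≟ (_ ∧′ _) = no λ ()
atom _ ≟ (_ ∨′ _) = no λ ()
atom _ ≟ (_ ⇒′ _) = no λ ()
atom _ ≟ (¬′ _) = no λ ()
atom _ ≟ (□ _) = no λ ()
⊤′ ≟ atom _ = no λ ()
⊤′ ≟ ⊥′ = no λ ()
⊤′ ≟ (_ ∧′ _) = no λ ()
⊤′ ≟ (_ ∨′ _) = no λ ()
⊤′ ≟ (_ ⇒′ _) = no λ ()
⊤′ ≟ (¬′ _) = no λ ()
⊤′ ≟ (□ _) = no λ ()
⊥′ ≟ atom _ = no λ ()
⊥′ ≟ ⊤′ = no λ ()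
⊥′ ≟ (_ ∧′ _) = no λ ()
⊥′ ≟ (_ ∨′ _) = no λ ()
⊥′ ≟ (_ ⇒′ _) = no λ ()
⊥′ ≟ (¬′ _) = no λ ()
⊥′ ≟ (□ _) = no λ ()
(_ ∧′ _) ≟ atom _ = no λ ()
(_ ∧′ _) ≟ ⊤′ = no λ ()
(_ ∧′ _) ≟ ⊥′ = no λ ()
(_ ∧′ _) ≟ (_ ∨′ _) = no λ ()
(_ ∧′ _) ≟ (_ ⇒′ _) = no λ ()
(_ ∧′ _) ≟ (¬′ _) = no λ ()
(_ ∧′ _) ≟ (□ _) = no λ ()
(_ ∨′ _) ≟ atom _ = no λ ()
(_ ∨′ _) ≟ ⊤′ = no λ ()
(_ ∨′ _) ≟ ⊥′ = no λ ()
(_ ∨′ _) ≟ (_ ∧′ _) = no λ ()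
(_ ∨′ _) ≟ (_ ⇒′ _) = no λ ()
(_ ∨′ _) ≟ (¬′ _) = no λ ()
(_ ∨′ _) ≟ (□ _) = no λ ()
(_ ⇒′ _) ≟ atom _ = no λ ()
(_ ⇒′ _) ≟ ⊤′ = no λ ()
(_ ⇒′ _) ≟ ⊥′ = no λ ()
(_ ⇒′ _) ≟ (_ ∧′ _) = no λ ()
(_ ⇒′ _) ≟ (_ ∨′ _) = no λ ()
(_ ⇒′ _) ≟ (¬′ _) = no λ ()
(_ ⇒′ _) ≟ (□ _) = no λ ()
(¬′ _) ≟ atom _ = no λ ()
(¬′ _) ≟ ⊤′ = no λ ()
(¬′ _) ≟ ⊥′ = no λ ()
(¬′ _) ≟ (_ ∧′ _) = no λ ()
(¬′ _) ≟ (_ ∨′ _) = no λ ()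
(¬′ _) ≟ (_ ⇒′ _) = no λ ()
(¬′ _) ≟ (□ _) = no λ ()
(□ _) ≟ atom _ = no λ ()
(□ _) ≟ ⊤′ = no λ ()
(□ _) ≟ ⊥′ = no λ ()
(□ _) ≟ (_ ∧′ _) = no λ ()
(□ _) ≟ (_ ∨′ _) = no λ ()
(□ _) ≟ (_ ⇒′ _) = no λ ()
(□ _) ≟ (¬′ _) = no λ ()

open import Data.List.Membership.DecPropositional _≟_ using (_∈?_)

-- Sequents (multisets represented as lists, compared up to permutation)

record Sequent : Set where
  constructor _⇒_
  field
    ant : List Fml
    suc′ : List Fml
open Sequent public

_≈_ : Sequent → Sequent → Set
S ≈ T = (ant S ↭ ant T) × (suc′ S ↭ suc′ T)

_·_ : Sequent → Sequent → Sequent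
S · T = (ant S ++ ant T) ⇒ (suc′ S ++ suc′ T)

□S : Sequent → Sequent
□S S = map □_ (ant S) ⇒ map □_ (suc′ S)

fmls : Sequent → List Fml
fmls S = ant S ++ suc′ S

SubfSeq : Sequent → Sequent → Set
SubfSeq S T = All (λ φ → Any (Subf φ) (fmls T)) (fmls S)

_≺⁻dm_ : List Fml → List Fml → Set
Γ ≺⁻dm Π = Σ Fml λ φ → Σ (List Fml) λ Π₀ → Σ (List Fml) λ L →
  (Π ↭ φ ∷ Π₀) × (Γ ↭ L ++ Π₀) × All (λ ψ → cpx ψ < cpx φ) L

data DMStep (Γ Π : List Fml) : Set where
  dm  : Γ ≺⁻dm Π → DMStep Γ Π
  eqm : Γ ↭ Π → DMStep Γ Π

_≼dm_ : List Fml → List Fml → Set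
Γ ≼dm Π = Star DMStep Γ Π

_≼_ : Sequent → Sequent → Set
S ≼ T = fmls S ≼dm fmls T

_≺_ : Sequent → Sequent → Set
S ≺ T = (S ≼ T) × ¬ (S ≈ T)

-- ψ ∈ Γ_⊡  (Γ_⊡ = ⊡Π for Π = {φ : φ ∈ Γ and □φ ∈ Γ})
InBox⊡ : Fml → List Fml → Set
InBox⊡ ψ Γ = ((ψ ∈ Γ) × (□ ψ ∈ Γ)) ⊎ (Σ Fml λ φ → (ψ ≡ □ φ) × (φ ∈ Γ) × (□ φ ∈ Γ))

inBox⊡? : (ψ : Fml) (Γ : List Fml) → Dec (InBox⊡ ψ Γ)
inBox⊡? ψ Γ with (ψ ∈? Γ) ×-dec (□ ψ ∈? Γ)
... | yes p = yes (inj₁ p)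
inBox⊡? (□ φ) Γ | no np with (φ ∈? Γ) ×-dec (□ φ ∈? Γ)
... | yes (a , b) = yes (inj₂ (φ , refl , a , b))
... | no nq = no λ { (inj₁ p) → np p ; (inj₂ (φ′ , refl , a , b)) → nq (a , b) }
inBox⊡? (atom x) Γ | no np = no λ { (inj₁ p) → np p ; (inj₂ (_ , () , _)) }
inBox⊡? ⊤′ Γ | no np = no λ { (inj₁ p) → np p ; (inj₂ (_ , () , _)) }
inBox⊡? ⊥′ Γ | no np = no λ { (inj₁ p) → np p ; (inj₂ (_ , () , _)) }
inBox⊡? (a ∧′ b) Γ | no np = no λ { (inj₁ p) → np p ; (inj₂ (_ , () , _)) }
inBox⊡? (a ∨′ b) Γ | no np = no λ { (inj₁ p) → np p ; (inj₂ (_ , () , _)) }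
inBox⊡? (a ⇒′ b) Γ | no np = no λ { (inj₁ p) → np p ; (inj₂ (_ , () , _)) }
inBox⊡? (¬′ a) Γ | no np = no λ { (inj₁ p) → np p ; (inj₂ (_ , () , _)) }

starL : List Fml → List Fml
starL Γ = deduplicate _≟_ (filter (λ ψ → inBox⊡? ψ Γ) Γ)
          ++ filter (λ ψ → ¬? (inBox⊡? ψ Γ)) Γ

star : Sequent → Sequent
star S = starL (ant S) ⇒ starL (suc′ S)

Calc : Set₁
Calc = List Sequent → Sequent → Set

_∪C_ : Calc → Calc → Calc
(C ∪C D) ps c = C ps c ⊎ D ps c

data G3p : Calc where
  ax   : ∀ Γ Δ p → G3p [] ((atom p ∷ Γ) ⇒ (atom p ∷ Δ))
  ax⊥  : ∀ Γ Δ → G3p [] ((⊥′ ∷ Γ) ⇒ Δ)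
  L∧   : ∀ Γ Δ φ ψ → G3p (((φ ∷ ψ ∷ Γ) ⇒ Δ) ∷ []) (((φ ∧′ ψ) ∷ Γ) ⇒ Δ)
  R∧   : ∀ Γ Δ φ ψ → G3p ((Γ ⇒ (φ ∷ Δ)) ∷ (Γ ⇒ (ψ ∷ Δ)) ∷ []) (Γ ⇒ ((φ ∧′ ψ) ∷ Δ))
  L∨   : ∀ Γ Δ φ ψ → G3p (((φ ∷ Γ) ⇒ Δ) ∷ ((ψ ∷ Γ) ⇒ Δ) ∷ []) (((φ ∨′ ψ) ∷ Γ) ⇒ Δ)
  R∨   : ∀ Γ Δ φ ψ → G3p ((Γ ⇒ (φ ∷ ψ ∷ Δ)) ∷ []) (Γ ⇒ ((φ ∨′ ψ) ∷ Δ))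
  L→   : ∀ Γ Δ φ ψ → G3p ((Γ ⇒ (φ ∷ Δ)) ∷ ((ψ ∷ Γ) ⇒ Δ) ∷ []) (((φ ⇒′ ψ) ∷ Γ) ⇒ Δ)
  R→   : ∀ Γ Δ φ ψ → G3p (((φ ∷ Γ) ⇒ (ψ ∷ Δ)) ∷ []) (Γ ⇒ ((φ ⇒′ ψ) ∷ Δ))

-- ⊢_C S : S has a (finite) proof in C.  Labels are taken up to multiset
-- equality; leaves are instances of premiss-free rules (axioms).
data Prov (C : Calc) (S : Sequent) : Set where
  node : ∀ {ps c} → C ps c → S ≈ c → All (Prov C) ps → Prov C S

-- circular proofs; `path` lists the labels of the nodes strictly below
data CProv′ (C : Calc) (path : List Sequent) (S : Sequent) : Set where
  circ : Any (λ T → T ≈ S) path → CProv′ C path S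
  node : ∀ {ps c} → C ps c → S ≈ c → All (CProv′ C (S ∷ path)) ps → CProv′ C path S

CProv : Calc → Sequent → Set
CProv C S = CProv′ C [] S

-- A box rule scheme: its schematic parameters P (values of all schematic
-- variables except the context variables Γ, Σ), premisses S₁…Sₙ and the
-- sequent S, with instances  prems p / □(core p) · (Γ ⇒ Σ).
record BoxScheme : Set₁ where
  constructor mkBS
  field
    Param : Set
    prems : Param → List Sequent
    core  : Param → Sequent
open BoxScheme public

BInst : BoxScheme → Calc
BInst R ps c = Σ (Param R) λ p → Σ (List Fml) λ Γ → Σ (List Fml) λ Δ →
  (ps ≡ prems R p) × (c ≡ (□S (core R p) · (Γ ⇒ Δ)))

Inst : BoxScheme → Calc
Inst R ps c = Σ (List Sequent) λ ps′ → Σ Sequent λ c′ →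
  BInst R ps′ c′ × Pointwise _≈_ ps ps′ × (c ≈ c′)

BoxSubf : BoxScheme → Set
BoxSubf R = ∀ p → All (λ Sᵢ → SubfSeq Sᵢ (core R p)) (prems R p)

BoxContr : BoxScheme → Set
BoxContr R = ∀ ps Γ Δ S₀ S₀′ → Inst R ps ((Γ ⇒ Δ) · □S (S₀ · (S₀′ · S₀′))) →
  Σ (List (Sequent × Sequent)) λ spl →
    Pointwise (λ Sᵢ st → Sᵢ ≈ (proj₁ st · (proj₂ st · proj₂ st))) ps spl ×
    Inst R (map (λ st → proj₁ st · proj₂ st) spl) ((Γ ⇒ Δ) · □S (S₀ · S₀′))

IsBoxRule : BoxScheme → Set
IsBoxRule R = BoxSubf R × BoxContr R

IsOrdered : BoxScheme → Set
IsOrdered R = ∀ ps c → BInst R ps c → All (λ Sᵢ → (Sᵢ ≺ c) × SubfSeq Sᵢ c) ps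

Slim : BoxScheme → Set
Slim R = ∀ ps c → Inst R ps c → Inst R (map star ps) c

RulesCalc : List BoxScheme → Calc
RulesCalc [] ps c = Empty.⊥
RulesCalc (R ∷ Rs) = BInst R ∪C RulesCalc Rs

G3pPlus : List BoxScheme → Calc
G3pPlus Rs = G3p ∪C RulesCalc Rs

_+R_ : Calc → BoxScheme → Calc
G +R R = G ∪C BInst R

-- Replace every R₁-step of a GR₁-proof by the R₂-step with the same conclusion;
-- its premisses are GR₁-provable by assumption and are translated in turn. This
-- terminates because a box rule's premisses are built from subformulas of
-- formulas that occur boxed in its conclusion, so a strict upper bound on the
-- complexity of the formulas drops, while G3p and ordered rules never raise it.
-- Only at bound 0 (an empty conclusion, hence empty R₂-premisses) does the
-- recursion stall; there the premisses repeat the conclusion and close as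
-- circular leaves.

module Submission where

open import Defs
open import Data.List using (List; []; _∷_; _++_; map)
open import Data.List.Extrema.Nat using (max; xs≤max)
open import Data.List.Relation.Unary.All as All using (All; []; _∷_)
import Data.List.Relation.Unary.All.Properties as All
open import Data.List.Relation.Unary.Any using (here)
open import Data.List.Relation.Binary.Permutation.Propositional using (↭-refl)
open import Data.List.Relation.Binary.Permutation.Propositional.Properties
  using (All-resp-↭; ++⁺)
open import Data.Nat using (ℕ; zero; suc; _<_; _≤_; _⊔_; s≤s; pred)
open import Data.Nat.Properties
  using (≤-refl; ≤-trans; ≤-<-trans; <-trans; n<1+n; m≤n⇒m≤1+n; m≤m⊔n; m≤n⊔m;
         m⊔n<o⇒m<o; m⊔n<o⇒n<o; <⇒≤pred)
open import Data.Product using (_×_; _,_; proj₂)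
open import Data.Sum using (inj₁; inj₂)
open import Relation.Binary.PropositionalEquality using (_≡_; refl)

Below : ℕ → Sequent → Set
Below n S = All (λ φ → cpx φ < n) (fmls S)

PreservesBound : Calc → Set
PreservesBound C = ∀ {n ps c} → C ps c → Below n c → All (Below n) ps

Subf⇒cpx≤ : ∀ {ψ φ} → Subf ψ φ → cpx ψ ≤ cpx φ
Subf⇒cpx≤ here = ≤-refl
Subf⇒cpx≤ (∧l s) = m≤n⇒m≤1+n (≤-trans (Subf⇒cpx≤ s) (m≤m⊔n _ _))
Subf⇒cpx≤ (∧r s) = m≤n⇒m≤1+n (≤-trans (Subf⇒cpx≤ s) (m≤n⊔m _ _))
Subf⇒cpx≤ (∨l s) = m≤n⇒m≤1+n (≤-trans (Subf⇒cpx≤ s) (m≤m⊔n _ _))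
Subf⇒cpx≤ (∨r s) = m≤n⇒m≤1+n (≤-trans (Subf⇒cpx≤ s) (m≤n⊔m _ _))
Subf⇒cpx≤ (⇒l s) = m≤n⇒m≤1+n (≤-trans (Subf⇒cpx≤ s) (m≤m⊔n _ _))
Subf⇒cpx≤ (⇒r s) = m≤n⇒m≤1+n (≤-trans (Subf⇒cpx≤ s) (m≤n⊔m _ _))
Subf⇒cpx≤ (¬s s) = m≤n⇒m≤1+n (Subf⇒cpx≤ s)
Subf⇒cpx≤ (□s s) = m≤n⇒m≤1+n (Subf⇒cpx≤ s)

SubfSeq-Below : ∀ {n} S T → SubfSeq S T → Below n T → Below n S
SubfSeq-Below _ _ sub bT =
  All.map (All.lookupWith (λ φ<n s → ≤-<-trans (Subf⇒cpx≤ s) φ<n) bT) sub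

Below-resp-≈ : ∀ {n S T} → S ≈ T → Below n S → Below n T
Below-resp-≈ (ant↭ , suc↭) = All-resp-↭ (++⁺ ant↭ suc↭)

Below-bound : ∀ S → Below (suc (max 0 (map cpx (fmls S)))) S
Below-bound S = All.map s≤s (All.map⁻ (xs≤max 0 (map cpx (fmls S))))

Below-zero⇒empty : ∀ S → Below 0 S → S ≡ ([] ⇒ [])
Below-zero⇒empty ([] ⇒ []) _ = refl
Below-zero⇒empty ([] ⇒ (_ ∷ _)) (() ∷ _)
Below-zero⇒empty ((_ ∷ _) ⇒ _) (() ∷ _)

Below-zero⇒≈ : ∀ {S T} → Below 0 S → Below 0 T → S ≈ T
Below-zero⇒≈ {S} {T} bS bT
  rewrite Below-zero⇒empty S bS | Below-zero⇒empty T bT = ↭-refl , ↭-refl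

suc⊔<⇒<×< : ∀ {a b n} → suc (a ⊔ b) < n → a < n × b < n
suc⊔<⇒<×< {a} {b} h = let a⊔b<n = <-trans (n<1+n (a ⊔ b)) h in
  m⊔n<o⇒m<o a b a⊔b<n , m⊔n<o⇒n<o a b a⊔b<n

G3p-preservesBound : PreservesBound G3p
G3p-preservesBound (ax Γ Δ p) b = []
G3p-preservesBound (ax⊥ Γ Δ) b = []
G3p-preservesBound (L∧ Γ Δ φ ψ) (h ∷ b) with suc⊔<⇒<×< h
... | φ< , ψ< = (φ< ∷ ψ< ∷ b) ∷ []
G3p-preservesBound (R∧ Γ Δ φ ψ) b with All.++⁻ Γ b
... | bΓ , h ∷ bΔ with suc⊔<⇒<×< h
... | φ< , ψ< = All.++⁺ bΓ (φ< ∷ bΔ) ∷ All.++⁺ bΓ (ψ< ∷ bΔ) ∷ []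
G3p-preservesBound (L∨ Γ Δ φ ψ) (h ∷ b) with suc⊔<⇒<×< h
... | φ< , ψ< = (φ< ∷ b) ∷ (ψ< ∷ b) ∷ []
G3p-preservesBound (R∨ Γ Δ φ ψ) b with All.++⁻ Γ b
... | bΓ , h ∷ bΔ with suc⊔<⇒<×< h
... | φ< , ψ< = All.++⁺ bΓ (φ< ∷ ψ< ∷ bΔ) ∷ []
G3p-preservesBound (L→ Γ Δ φ ψ) (h ∷ b) with All.++⁻ Γ b | suc⊔<⇒<×< h
... | bΓ , bΔ | φ< , ψ< = All.++⁺ bΓ (φ< ∷ bΔ) ∷ (ψ< ∷ b) ∷ []
G3p-preservesBound (R→ Γ Δ φ ψ) b with All.++⁻ Γ b
... | bΓ , h ∷ bΔ with suc⊔<⇒<×< h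
... | φ< , ψ< = (φ< ∷ All.++⁺ bΓ (ψ< ∷ bΔ)) ∷ []

ordered-preservesBound : ∀ {R} → IsOrdered R → PreservesBound (BInst R)
ordered-preservesBound ordered {ps = ps} {c} inst bc =
  All.map (λ {S} prem → SubfSeq-Below S c (proj₂ prem) bc) (ordered ps c inst)

G3pPlus-preservesBound : ∀ {Rs} → All (λ R → IsBoxRule R × IsOrdered R) Rs →
  PreservesBound (G3pPlus Rs)
G3pPlus-preservesBound hRs (inj₁ r) = G3p-preservesBound r
G3pPlus-preservesBound hRs (inj₂ r) = rules hRs r
  where
  rules : ∀ {Rs} → All (λ R → IsBoxRule R × IsOrdered R) Rs → PreservesBound (RulesCalc Rs)
  rules ((_ , ordered) ∷ _) (inj₁ r) = ordered-preservesBound ordered r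
  rules (_ ∷ hRs) (inj₂ r) = rules hRs r

□-Below : ∀ {m} S T → Below m (□S S · T) → Below (pred m) S
□-Below S T b with All.++⁻ (ant (□S S) ++ ant T) b
... | bant , bsuc = All.++⁺ (boxed (ant S) (All.++⁻ˡ (map □_ (ant S)) bant))
                           (boxed (suc′ S) (All.++⁻ˡ (map □_ (suc′ S)) bsuc))
  where
  boxed : ∀ {m} xs → All (λ φ → cpx φ < m) (map □_ xs) → All (λ φ → cpx φ < pred m) xs
  boxed xs bs = All.map <⇒≤pred (All.map⁻ bs)

BoxSubf-Below : ∀ {m} R → BoxSubf R → ∀ p T →
  Below m (□S (core R p) · T) → All (Below (pred m)) (prems R p)
BoxSubf-Below R subf p T b =
  All.map (λ {S} sub → SubfSeq-Below S (core R p) sub (□-Below (core R p) T b)) (subf p)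

module Replacement (G : Calc) (G-preservesBound : PreservesBound G)
  (P : Set) (core₀ : P → Sequent) (prems₁ prems₂ : P → List Sequent)
  (R₂-subf : BoxSubf (mkBS P prems₂ core₀))
  (derivable : ∀ p → All (Prov (G +R mkBS P prems₁ core₀)) (prems₁ p) →
                     All (Prov (G +R mkBS P prems₁ core₀)) (prems₂ p)) where

  G₁ G₂ : Calc
  G₁ = G +R mkBS P prems₁ core₀
  G₂ = G +R mkBS P prems₂ core₀

  circular-leaves : ∀ {path S} ts → Below 0 S → All (Below 0) ts → All (CProv′ G₂ (S ∷ path)) ts
  circular-leaves ts bS = All.map (λ bt → circ (here (Below-zero⇒≈ bS bt)))

  mutual
    replace : ∀ n {path S} → Below n S → Prov G₁ S → CProv′ G₂ path S
    replace n b (node (inj₁ r) eq ds) =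
      node (inj₁ r) eq (replace* n (G-preservesBound r (Below-resp-≈ eq b)) ds)
    replace zero b (node (inj₂ (p , Γ , Δ , refl , refl)) eq ds) =
      node (inj₂ (p , Γ , Δ , refl , refl)) eq
        (circular-leaves (prems₂ p) b (BoxSubf-Below (mkBS P prems₂ core₀) R₂-subf p (Γ ⇒ Δ) (Below-resp-≈ eq b)))
    replace (suc n) b (node (inj₂ (p , Γ , Δ , refl , refl)) eq ds) =
      node (inj₂ (p , Γ , Δ , refl , refl)) eq
        (replace* n (BoxSubf-Below (mkBS P prems₂ core₀) R₂-subf p (Γ ⇒ Δ) (Below-resp-≈ eq b)) (derivable p ds))

    replace* : ∀ n {path ps} → All (Below n) ps → All (Prov G₁) ps → All (CProv′ G₂ path) ps
    replace* n [] [] = []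
    replace* n (b ∷ bs) (d ∷ ds) = replace n b d ∷ replace* n bs ds

lemma3p1 : (Rs : List BoxScheme) → All (λ R → IsBoxRule R × IsOrdered R) Rs →
    (P : Set) (core₀ : P → Sequent) (prems₁ prems₂ : P → List Sequent) →
    IsBoxRule (mkBS P prems₁ core₀) → Slim (mkBS P prems₁ core₀) →
    IsBoxRule (mkBS P prems₂ core₀) → Slim (mkBS P prems₂ core₀) →
    (∀ p → All (Prov (G3pPlus Rs +R mkBS P prems₁ core₀)) (prems₁ p) →
           All (Prov (G3pPlus Rs +R mkBS P prems₁ core₀)) (prems₂ p)) →
    ∀ S → Prov (G3pPlus Rs +R mkBS P prems₁ core₀) S →
      CProv (G3pPlus Rs +R mkBS P prems₂ core₀) S
lemma3p1 Rs hRs P core₀ prems₁ prems₂ _ _ (R₂-subf , _) _ derivable S d =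
  replace (suc (max 0 (map cpx (fmls S)))) (Below-bound S) d
  where
  open Replacement (G3pPlus Rs) (G3pPlus-preservesBound hRs) P core₀ prems₁ prems₂ R₂-subf derivable
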